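{- For every graph $G$ and every integer $r\geq\chi(G)$, it holds that $\mathrm{fix}_{r+1}(G)\leq\mathrm{fix}_r(G)$.
   Context: An $r$-coloring of $G$ is any map $V(G)\to\{1,\dots,r\}$; it is proper if adjacent vertices receive different colors; $\chi(G)$ is the chromatic number. For an $r$-coloring $\varphi$, $\mathrm{fix}^{\varphi}_r(G)$ is the minimum, over all proper $r$-colorings $\varphi'$ of $G$, of the number of vertices on which $\varphi$ and $\varphi'$ differ ($\infty$ if $r<\chi(G)$). The $r$-fixing number is $\mathrm{fix}_r(G)=\max_{\varphi}\mathrm{fix}^{\varphi}_r(G)$, the maximum over all $r$-colorings $\varphi$ of $G$. -}

module Defs where

open import Data.Nat using (ℕ; zero; suc; _+_; _≤_)
open import Data.Fin using (Fin; zero; suc)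
open import Data.Fin.Properties using (_≟_)
open import Data.Product using (Σ; ∃; _×_; _,_)
open import Relation.Nullary using (¬_; yes; no)
open import Relation.Binary.PropositionalEquality using (_≡_; _≢_)

record Graph : Set₁ where
  field
    n     : ℕ
    Adj   : Fin n → Fin n → Set
    sym   : ∀ {u v} → Adj u v → Adj v u
    irrefl : ∀ {u} → ¬ Adj u u
open Graph public

Coloring : Graph → ℕ → Set
Coloring G r = Fin (n G) → Fin r

Proper : (G : Graph) {r : ℕ} → Coloring G r → Set
Proper G φ = ∀ u v → Adj G u v → φ u ≢ φ v

Colorable : Graph → ℕ → Set
Colorable G r = Σ (Coloring G r) (Proper G)

IsChromaticNumber : Graph → ℕ → Set
IsChromaticNumber G c = Colorable G c × (∀ k → Colorable G k → c ≤ k)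

diffCount : ∀ {m r} → (Fin m → Fin r) → (Fin m → Fin r) → ℕ
diffCount {zero}  f g = 0
diffCount {suc m} f g with f zero ≟ g zero
... | yes _ = diffCount (λ i → f (suc i)) (λ i → g (suc i))
... | no  _ = suc (diffCount (λ i → f (suc i)) (λ i → g (suc i)))

-- k = fix^φ_r(G) (finite case): k is the minimum, over proper r-colorings φ',
-- of the number of vertices where φ and φ' differ.
IsFixAt : (G : Graph) (r : ℕ) → Coloring G r → ℕ → Set
IsFixAt G r φ k =
  (Σ (Coloring G r) λ φ' → Proper G φ' × diffCount φ φ' ≡ k)
  × (∀ φ' → Proper G φ' → k ≤ diffCount φ φ')

IsFix : (G : Graph) (r : ℕ) → ℕ → Set
IsFix G r k =
  (∀ φ → Σ ℕ λ j → IsFixAt G r φ j × j ≤ k)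
  × (Σ (Coloring G r) λ φ → IsFixAt G r φ k)

-- Let φ be an (r+1)-coloring attaining fix_{r+1}(G), and squash its top color r+1 into
-- some color ≤ r, giving an r-coloring ψ. A proper r-coloring ψ' closest to ψ lifts to a
-- proper (r+1)-coloring φ': keep φ(v) where ψ' agrees with ψ, use ψ'(v) elsewhere. Then
-- φ' differs from φ exactly where ψ' differs from ψ, so fix_{r+1}(G) ≤ fix^ψ_r(G) ≤ fix_r(G).
module Submission where

open import Defs
open import Data.Nat using (ℕ; zero; suc; _≤_; z≤n)
open import Data.Nat.Properties using (≤-trans; ≤-reflexive; module ≤-Reasoning)
open import Data.Fin using (Fin; zero; suc; inject₁)
open import Data.Fin.Properties using (_≟_)
open import Data.Product using (_,_)
open import Function using (_∘_)
open import Relation.Nullary using (yes; no; contradiction)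
open import Relation.Binary.PropositionalEquality
  using (_≡_; refl; cong; trans) renaming (sym to ≡-sym)

squash : ∀ {s} → Fin (suc (suc s)) → Fin (suc s)
squash {zero}  _       = zero
squash {suc s} zero    = zero
squash {suc s} (suc i) = suc (squash i)

squash-inject₁ : ∀ {s} (i : Fin (suc s)) → squash (inject₁ i) ≡ i
squash-inject₁ {zero}  zero    = refl
squash-inject₁ {suc s} zero    = refl
squash-inject₁ {suc s} (suc i) = cong suc (squash-inject₁ i)

diffCount-cong : ∀ {m r s} (f g : Fin m → Fin r) (h k : Fin m → Fin s) →
                 (∀ i → f i ≡ g i → h i ≡ k i) → (∀ i → h i ≡ k i → f i ≡ g i) →
                 diffCount f g ≡ diffCount h k
diffCount-cong {zero}  f g h k _  _  = refl
diffCount-cong {suc m} f g h k to from with f zero ≟ g zero | h zero ≟ k zero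
... | yes _   | yes _   = diffCount-cong _ _ _ _ (to ∘ suc) (from ∘ suc)
... | yes f≡g | no  h≢k = contradiction (to zero f≡g) h≢k
... | no  f≢g | yes h≡k = contradiction (from zero h≡k) f≢g
... | no  _   | no  _   = cong suc (diffCount-cong _ _ _ _ (to ∘ suc) (from ∘ suc))

diffCount-empty : ∀ {m r} → (Fin m → Fin 0) → (f g : Fin m → Fin r) → diffCount f g ≡ 0
diffCount-empty {zero}  _ f g = refl
diffCount-empty {suc m} e f g with e zero
... | ()

module Lift (G : Graph) {r : ℕ} (ρ : Fin (suc r) → Fin r)
            (ρ-inject₁ : ∀ i → ρ (inject₁ i) ≡ i)
            (φ : Coloring G (suc r)) (ψ' : Coloring G r) where

  ψ : Coloring G r
  ψ = ρ ∘ φ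

  lift : Coloring G (suc r)
  lift v with ψ' v ≟ ψ v
  ... | yes _ = φ v
  ... | no  _ = inject₁ (ψ' v)

  ρ∘lift≡ψ' : ∀ v → ρ (lift v) ≡ ψ' v
  ρ∘lift≡ψ' v with ψ' v ≟ ψ v
  ... | yes ψ'≡ψ = ≡-sym ψ'≡ψ
  ... | no  _    = ρ-inject₁ (ψ' v)

  φ≡lift⇒ψ≡ψ' : ∀ v → φ v ≡ lift v → ψ v ≡ ψ' v
  φ≡lift⇒ψ≡ψ' v e = trans (cong ρ e) (ρ∘lift≡ψ' v)

  ψ≡ψ'⇒φ≡lift : ∀ v → ψ v ≡ ψ' v → φ v ≡ lift v
  ψ≡ψ'⇒φ≡lift v e with ψ' v ≟ ψ v
  ... | yes _    = refl
  ... | no  ψ'≢ψ = contradiction (≡-sym e) ψ'≢ψ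

  lift-proper : Proper G ψ' → Proper G lift
  lift-proper ψ'-proper u v adj e =
    ψ'-proper u v adj (trans (≡-sym (ρ∘lift≡ψ' u)) (trans (cong ρ e) (ρ∘lift≡ψ' v)))

  diffCount-lift : diffCount φ lift ≡ diffCount ψ ψ'
  diffCount-lift = diffCount-cong φ lift ψ ψ' φ≡lift⇒ψ≡ψ' ψ≡ψ'⇒φ≡lift

lemma28 : (G : Graph) (χ r : ℕ) → IsChromaticNumber G χ → χ ≤ r →
          (a b : ℕ) → IsFix G (suc r) a → IsFix G r b → a ≤ b
lemma28 G χ zero _ _ a b (_ , φ , (φ' , _ , a≡diff) , _) (_ , φ₀ , _) =
  ≤-trans (≤-reflexive (trans (≡-sym a≡diff) (diffCount-empty φ₀ φ φ'))) z≤n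
lemma28 G χ (suc s) _ _ a b (_ , φ , _ , φ-min) (fix-r , _)
  with fix-r (squash ∘ φ)
... | j , ((ψ' , ψ'-proper , ψ'-diff) , _) , j≤b = begin
  a                         ≤⟨ φ-min lift (lift-proper ψ'-proper) ⟩
  diffCount φ lift          ≡⟨ diffCount-lift ⟩
  diffCount (squash ∘ φ) ψ' ≡⟨ ψ'-diff ⟩
  j                         ≤⟨ j≤b ⟩
  b                         ∎
  where
    open ≤-Reasoning
    open Lift G squash squash-inject₁ φ ψ'
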